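{- For every $v\le c$ and every $k_0\in\{0,\dots,\kappa-1\}$, $$\mathrm{OPT}^{(k_0)}_v\Big(\bigcup_{k=0}^{k_0+1}\tilde I_k\ \cup\bigcup_{k=k_0+2}^{\kappa}I_k\Big)\ \ge\ \left(1-\frac{\varepsilon}{4}\cdot\frac{1}{\log_2(2/\varepsilon)+1}\right)^{k_0+1}\mathrm{OPT}_v(I_L^{red}).$$
   Context: UKP instance $I$: items with profits $p(a)\in(0,1]$, sizes $s(a)\in(0,1]$, capacity $c=1$. For a set $I'$ of items and $0\le v\le c$, $\mathrm{OPT}_v(I')=\max\{\sum_{a\in I'}p(a)x_a:\sum_{a\in I'}s(a)x_a\le v,\ x_a\in\mathbb{N}\}$. Let $\varepsilon=1/2^{\kappa-1}$, $\kappa\in\mathbb{N}$, $\varepsilon\le1/4$. Let $a_{me}$ maximize $p/s$ over $I$, $P_0=p(a_{me})\lfloor c/s(a_{me})\rfloor$, $T=\frac12\varepsilon P_0$, $K=\frac14\cdot\frac1{\kappa+1}\varepsilon T$, $I_L=\{a\in I:p(a)\ge T\}$. Standing assumption: $I$ contains no item of profit $2P_0$. For $k\in\{0,\dots,\kappa\}$ let $L_k=[2^kT,2^{k+1}T)$ and for $\gamma\in\{0,\dots,2^{\kappa+1}(\kappa+1)-1\}$ let $L_{k,\gamma}=[2^kT+\gamma2^kK,\ 2^kT+(\gamma+1)2^kK)$. Let $a_{k,\gamma}$ be an item of minimum size among items of $I_L$ with profit in $L_{k,\gamma}$ (if any), $I_L^{red}$ the set of all existing $a_{k,\gamma}$,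 and $I_k=\{a\in I_L^{red}:p(a)\in L_k\}$. Gluing: for items $a_1,a_2$ with $s(a_1)+s(a_2)\le c$, $a_1\oplus a_2$ is a new item with profit $p(a_1)+p(a_2)$ and size $s(a_1)+s(a_2)$; glued items are treated as ordinary items. Define $\tilde I_0=I_0$ and, for $k=0,\dots,\kappa-1$ and each $\gamma$, let $\tilde a_{k+1,\gamma}$ be an item of minimum size among the items of $I_{k+1}\cup\{\tilde a\oplus\tilde a':\tilde a,\tilde a'\in\tilde I_k \text{ (possibly equal)},\ s(\tilde a)+s(\tilde a')\le c\}$ whose profit lies in $L_{k+1,\gamma}$ (if any), and $\tilde I_{k+1}$ the set of all existing $\tilde a_{k+1,\gamma}$. Structured optimum: for a set $I'$ of items each of profit at least $T$, $v\le c$ and $k_0\in\{0,\dots,\kappa\}$, $\mathrm{OPT}^{(k_0)}_v(I')$ is the maximum profit of a multiset of items of $I'$ of total size at most $v$ that contains, for each $k\in\{0,\dots,k_0\}$, at most one item copy with profit in $L_k$. -}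

module Defs where

open import Data.Nat as ℕ using (ℕ; zero; suc)
open import Data.Integer using (+_)
open import Data.Rational
open import Data.Rational.Properties using (_≤?_; _<?_)
open import Data.Product using (_×_; _,_; ∃; ∃-syntax; proj₁; proj₂)
open import Data.Sum using (_⊎_)
open import Data.Maybe using (Maybe; just; nothing)
open import Data.List using (List; filter; length; foldr; map)
open import Data.List.Membership.Propositional using (_∈_)
open import Data.Empty using (⊥)
open import Relation.Nullary using (Dec; yes; no)
open import Relation.Nullary.Decidable using (_×-dec_)
open import Relation.Binary.PropositionalEquality using (_≡_)

Item : Set
Item = ℚ × ℚ

profit : Item → ℚ
profit = proj₁

size : Item → ℚ
size = proj₂

ℕ→ℚ : ℕ → ℚ
ℕ→ℚ n = + n / 1

pow : ℚ → ℕ → ℚ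
pow q zero    = 1ℚ
pow q (suc n) = q * pow q n

_⊕_ : Item → Item → Item
a ⊕ b = (profit a + profit b , size a + size b)

-- total profit / size of a multiset (list) of item copies
totalProfit : List Item → ℚ
totalProfit xs = foldr _+_ 0ℚ (map profit xs)

totalSize : List Item → ℚ
totalSize xs = foldr _+_ 0ℚ (map size xs)

InBand : ℚ → ℚ → Item → Set
InBand lo hi a = lo ≤ profit a × profit a < hi

inBand? : (lo hi : ℚ) (a : Item) → Dec (InBand lo hi a)
inBand? lo hi a = (lo ≤? profit a) ×-dec (profit a <? hi)

countBand : ℚ → ℚ → List Item → ℕ
countBand lo hi xs = length (filter (inBand? lo hi) xs)

ValidMin : (Item → Set) → ℚ → ℚ → Maybe Item → Set
ValidMin Cand lo hi nothing  = ∀ a → Cand a → InBand lo hi a → ⊥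
ValidMin Cand lo hi (just a) =
  Cand a × InBand lo hi a × (∀ b → Cand b → InBand lo hi b → size a ≤ size b)

eps : ℕ → ℚ
eps κ = pow ½ (κ ℕ.∸ 1)

thrT : ℕ → ℚ → ℚ
thrT κ P₀ = ½ * eps κ * P₀

thrK : ℕ → ℚ → ℚ
thrK κ P₀ = (½ * ½) * (+ 1 / suc κ) * eps κ * thrT κ P₀

Γ : ℕ → ℕ
Γ κ = (2 ℕ.^ suc κ) ℕ.* suc κ

Llo Lhi : ℕ → ℚ → ℕ → ℚ
Llo κ P₀ k = ℕ→ℚ (2 ℕ.^ k) * thrT κ P₀
Lhi κ P₀ k = ℕ→ℚ (2 ℕ.^ suc k) * thrT κ P₀

Lglo Lghi : ℕ → ℚ → ℕ → ℕ → ℚ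
Lglo κ P₀ k γ = ℕ→ℚ (2 ℕ.^ k) * thrT κ P₀ + ℕ→ℚ γ * ℕ→ℚ (2 ℕ.^ k) * thrK κ P₀
Lghi κ P₀ k γ = ℕ→ℚ (2 ℕ.^ k) * thrT κ P₀ + ℕ→ℚ (suc γ) * ℕ→ℚ (2 ℕ.^ k) * thrK κ P₀

-- the approximation factor 1 - (ε/4) · 1/(log₂(2/ε) + 1), where log₂(2/ε) = κ
factor : ℕ → ℚ
factor κ = 1ℚ - (eps κ * (½ * ½)) * (+ 1 / suc κ)

-- The selections a_{k,γ} and ã_{k,γ} are modelled as arbitrary functions
-- sel, tsel : ℕ → ℕ → Maybe Item satisfying the defining "minimum size"
-- property (any tie-breaking is allowed).

InIL : List Item → ℕ → ℚ → Item → Set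
InIL I κ P₀ a = a ∈ I × thrT κ P₀ ≤ profit a

ValidRed : List Item → ℕ → ℚ → (ℕ → ℕ → Maybe Item) → Set
ValidRed I κ P₀ sel =
  ∀ k γ → k ℕ.≤ κ → γ ℕ.< Γ κ →
    ValidMin (InIL I κ P₀) (Lglo κ P₀ k γ) (Lghi κ P₀ k γ) (sel k γ)

InIk : ℕ → (ℕ → ℕ → Maybe Item) → ℕ → Item → Set
InIk κ sel k a = ∃[ γ ] (γ ℕ.< Γ κ × sel k γ ≡ just a)

InRed : ℕ → (ℕ → ℕ → Maybe Item) → Item → Set
InRed κ sel a = ∃[ k ] (k ℕ.≤ κ × InIk κ sel k a)

CandTilde : ℕ → (ℕ → ℕ → Maybe Item) → (ℕ → ℕ → Maybe Item) → ℕ → Item → Set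
CandTilde κ sel tsel k a =
  InIk κ sel (suc k) a
  ⊎ (∃[ b ] ∃[ b' ] (InIk κ tsel k b × InIk κ tsel k b'
                      × size b + size b' ≤ 1ℚ × a ≡ b ⊕ b'))

ValidTilde : ℕ → ℚ → (ℕ → ℕ → Maybe Item) → (ℕ → ℕ → Maybe Item) → Set
ValidTilde κ P₀ sel tsel =
  (∀ γ → γ ℕ.< Γ κ → tsel 0 γ ≡ sel 0 γ)
  × (∀ k γ → k ℕ.< κ → γ ℕ.< Γ κ →
       ValidMin (CandTilde κ sel tsel k) (Lglo κ P₀ (suc k) γ) (Lghi κ P₀ (suc k) γ)
                (tsel (suc k) γ))

InMixed : ℕ → (ℕ → ℕ → Maybe Item) → (ℕ → ℕ → Maybe Item) → ℕ → Item → Set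
InMixed κ sel tsel k₀ a =
  (∃[ k ] (k ℕ.≤ suc k₀ × InIk κ tsel k a))
  ⊎ (∃[ k ] (suc (suc k₀) ℕ.≤ k × k ℕ.≤ κ × InIk κ sel k a))

Structured : ℕ → ℚ → ℕ → List Item → Set
Structured κ P₀ k₀ ys = ∀ k → k ℕ.≤ k₀ → countBand (Llo κ P₀ k) (Lhi κ P₀ k) ys ℕ.≤ 1

-- Process the bands L_0, …, L_{k₀} in turn, transforming the given multiset xs. Before stage j
-- every copy is either settled (in some Ĩ_k with k < j, at most one copy per band) or pending
-- (in Ĩ_j, or in some I_k with k > j). Stage j glues the pending Ĩ_j-copies in pairs; a glued
-- pair has profit in L_{j+1}, as has every pending I_{j+1}-copy, and each of these is replaced by
-- the item ã_{j+1,γ} chosen for its subinterval, which is no larger. Since L_{k,γ} has width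
-- 2^k K = δ·2^k T with δ = ε/(4(κ+1)), the replacement keeps a (1 − δ)-fraction of the profit.
-- A Ĩ_j-copy left unpaired is settled. After stage k₀ the multiset is structured up to k₀ and
-- has lost at most the factor (1 − δ)^{k₀+1}.

module Submission where

open import Defs
open import Data.Nat as ℕ using (ℕ; zero; suc; z≤n; s≤s)
import Data.Nat.Properties as ℕₚ
open import Data.Integer as ℤ using (+_)
import Data.Integer.Properties as ℤₚ
open import Data.Rational
open import Data.Rational.Properties
open import Data.Rational.Unnormalised as ℚᵘ using (mkℚᵘ; *≡*) renaming (_≃_ to _≃ᵘ_)
import Data.Rational.Unnormalised.Properties as ℚᵘₚ
open import Data.Rational.Solver using (module +-*-Solver)
open import Data.Product using (_×_; _,_; ∃-syntax; proj₁; proj₂)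
open import Data.Sum using (_⊎_; inj₁; inj₂)
open import Data.Maybe using (Maybe; just; nothing)
open import Data.Maybe.Relation.Unary.All as Maybe using (just; nothing)
open import Data.List using (List; []; _∷_; _++_; filter; length; fromMaybe)
import Data.List.Properties as Listₚ
open import Data.List.Membership.Propositional using (_∈_)
open import Data.List.Relation.Unary.All as All using (All; []; _∷_)
open import Data.List.Relation.Unary.All.Properties using (++⁺)
open import Data.Empty using (⊥-elim)
open import Data.Unit using (tt)
open import Relation.Nullary using (¬_; Dec; yes; no)
open import Relation.Nullary.Decidable using (toWitness)
open import Relation.Binary using (Tri; tri<; tri≈; tri>)
open import Relation.Binary.PropositionalEquality
open +-*-Solver

toℚᵘ-ℕ→ℚ : ∀ n → toℚᵘ (ℕ→ℚ n) ≃ᵘ mkℚᵘ (+ n) 0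
toℚᵘ-ℕ→ℚ n = toℚᵘ-fromℚᵘ (mkℚᵘ (+ n) 0)

ℕ→ℚ-+ : ∀ m n → ℕ→ℚ (m ℕ.+ n) ≡ ℕ→ℚ m + ℕ→ℚ n
ℕ→ℚ-+ m n = toℚᵘ-injective (begin
  toℚᵘ (ℕ→ℚ (m ℕ.+ n))              ≈⟨ toℚᵘ-ℕ→ℚ (m ℕ.+ n) ⟩
  mkℚᵘ (+ (m ℕ.+ n)) 0              ≈⟨ *≡* (cong (ℤ._* + 1) (cong₂ ℤ._+_ (sym (ℤₚ.*-identityʳ (+ m)))
                                                                     (sym (ℤₚ.*-identityʳ (+ n))))) ⟩
  mkℚᵘ (+ m) 0 ℚᵘ.+ mkℚᵘ (+ n) 0    ≈⟨ ℚᵘₚ.+-cong (toℚᵘ-ℕ→ℚ m) (toℚᵘ-ℕ→ℚ n) ⟨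
  toℚᵘ (ℕ→ℚ m) ℚᵘ.+ toℚᵘ (ℕ→ℚ n)    ≈⟨ toℚᵘ-homo-+ (ℕ→ℚ m) (ℕ→ℚ n) ⟨
  toℚᵘ (ℕ→ℚ m + ℕ→ℚ n)              ∎)
  where open ℚᵘₚ.≃-Reasoning

ℕ→ℚ-* : ∀ m n → ℕ→ℚ (m ℕ.* n) ≡ ℕ→ℚ m * ℕ→ℚ n
ℕ→ℚ-* m n = toℚᵘ-injective (begin
  toℚᵘ (ℕ→ℚ (m ℕ.* n))              ≈⟨ toℚᵘ-ℕ→ℚ (m ℕ.* n) ⟩
  mkℚᵘ (+ (m ℕ.* n)) 0              ≈⟨ *≡* (cong (ℤ._* + 1) (ℤₚ.pos-* m n)) ⟩
  mkℚᵘ (+ m) 0 ℚᵘ.* mkℚᵘ (+ n) 0    ≈⟨ ℚᵘₚ.*-cong (toℚᵘ-ℕ→ℚ m) (toℚᵘ-ℕ→ℚ n) ⟨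
  toℚᵘ (ℕ→ℚ m) ℚᵘ.* toℚᵘ (ℕ→ℚ n)    ≈⟨ toℚᵘ-homo-* (ℕ→ℚ m) (ℕ→ℚ n) ⟨
  toℚᵘ (ℕ→ℚ m * ℕ→ℚ n)              ∎)
  where open ℚᵘₚ.≃-Reasoning

ℕ→ℚ-inverse : ∀ n → ℕ→ℚ (suc n) * (+ 1 / suc n) ≡ 1ℚ
ℕ→ℚ-inverse n = toℚᵘ-injective (begin
  toℚᵘ (ℕ→ℚ (suc n) * (+ 1 / suc n))            ≈⟨ toℚᵘ-homo-* (ℕ→ℚ (suc n)) (+ 1 / suc n) ⟩
  toℚᵘ (ℕ→ℚ (suc n)) ℚᵘ.* toℚᵘ (+ 1 / suc n)    ≈⟨ ℚᵘₚ.*-cong (toℚᵘ-ℕ→ℚ (suc n)) (toℚᵘ-fromℚᵘ (mkℚᵘ (+ 1) n)) ⟩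
  mkℚᵘ (+ suc n) 0 ℚᵘ.* mkℚᵘ (+ 1) n            ≈⟨ *≡* (cong (λ k → + suc k) n*1*1≡n+0+0) ⟩
  ℚᵘ.1ℚᵘ                                        ∎)
  where
  open ℚᵘₚ.≃-Reasoning
  n*1*1≡n+0+0 : n ℕ.* 1 ℕ.* 1 ≡ n ℕ.+ 0 ℕ.+ 0
  n*1*1≡n+0+0 = trans (ℕₚ.*-identityʳ (n ℕ.* 1)) (trans (ℕₚ.*-identityʳ n)
                  (sym (trans (ℕₚ.+-identityʳ (n ℕ.+ 0)) (ℕₚ.+-identityʳ n))))

ℕ→ℚ-nonNeg : ∀ n → 0ℚ ≤ ℕ→ℚ n
ℕ→ℚ-nonNeg n = nonNegative⁻¹ (ℕ→ℚ n) {{normalize-nonNeg n 1}}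

1/suc-nonNeg : ∀ n → 0ℚ ≤ + 1 / suc n
1/suc-nonNeg n = nonNegative⁻¹ (+ 1 / suc n) {{normalize-nonNeg 1 (suc n)}}

<⇒≱ : ∀ {p q} → p < q → ¬ (q ≤ p)
<⇒≱ p<q q≤p = <-irrefl refl (<-≤-trans p<q q≤p)

*-monoˡ-≤-≥0 : ∀ {r p q} → 0ℚ ≤ r → p ≤ q → r * p ≤ r * q
*-monoˡ-≤-≥0 {r} 0≤r = *-monoˡ-≤-nonNeg r {{nonNegative 0≤r}}

*-monoʳ-≤-≥0 : ∀ {r p q} → 0ℚ ≤ r → p ≤ q → p * r ≤ q * r
*-monoʳ-≤-≥0 {r} 0≤r = *-monoʳ-≤-nonNeg r {{nonNegative 0≤r}}

*-≥0 : ∀ {p q} → 0ℚ ≤ p → 0ℚ ≤ q → 0ℚ ≤ p * q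
*-≥0 {p} {q} 0≤p 0≤q = subst (_≤ p * q) (*-zeroˡ q) (*-monoʳ-≤-≥0 0≤q 0≤p)

+-≥0 : ∀ {p q} → 0ℚ ≤ p → 0ℚ ≤ q → 0ℚ ≤ p + q
+-≥0 = +-mono-≤

p≤p+q : ∀ {p q} → 0ℚ ≤ q → p ≤ p + q
p≤p+q {p} {q} 0≤q = subst (_≤ p + q) (+-identityʳ p) (+-monoʳ-≤ p 0≤q)

p≤q+p : ∀ {p q} → 0ℚ ≤ q → p ≤ q + p
p≤q+p {p} {q} 0≤q = subst (_≤ q + p) (+-identityˡ p) (+-monoˡ-≤ p 0≤q)

+-cancelʳ-≤ : ∀ {p q} r → p + r ≤ q + r → p ≤ q
+-cancelʳ-≤ {p} {q} r p+r≤q+r = subst₂ _≤_ (cancel p) (cancel q) (+-monoˡ-≤ (- r) p+r≤q+r)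
  where
  cancel : ∀ x → x + r + - r ≡ x
  cancel x = solve 2 (λ x r → x :+ r :+ (:- r) := x) refl x r

q*p≤p : ∀ {p q} → 0ℚ ≤ p → q ≤ 1ℚ → q * p ≤ p
q*p≤p {p} {q} 0≤p q≤1 = subst (q * p ≤_) (*-identityˡ p) (*-monoʳ-≤-≥0 0≤p q≤1)

1-p+p≡1 : ∀ p → 1ℚ - p + p ≡ 1ℚ
1-p+p≡1 = solve 1 (λ p → con 1ℚ :- p :+ p := con 1ℚ) refl

1-p≤1 : ∀ {p} → 0ℚ ≤ p → 1ℚ - p ≤ 1ℚ
1-p≤1 {p} 0≤p = +-cancelʳ-≤ p (subst (_≤ 1ℚ + p) (sym (1-p+p≡1 p)) (p≤p+q 0≤p))

0≤1-p : ∀ {p} → p ≤ 1ℚ → 0ℚ ≤ 1ℚ - p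
0≤1-p {p} p≤1 = +-cancelʳ-≤ p (subst₂ _≤_ (sym (+-identityˡ p)) (sym (1-p+p≡1 p)) p≤1)

ℕ→ℚ-mono-≤ : ∀ {m n} → m ℕ.≤ n → ℕ→ℚ m ≤ ℕ→ℚ n
ℕ→ℚ-mono-≤ {m} {n} m≤n = begin
  ℕ→ℚ m                    ≤⟨ p≤p+q (ℕ→ℚ-nonNeg (n ℕ.∸ m)) ⟩
  ℕ→ℚ m + ℕ→ℚ (n ℕ.∸ m)    ≡⟨ ℕ→ℚ-+ m (n ℕ.∸ m) ⟨
  ℕ→ℚ (m ℕ.+ (n ℕ.∸ m))    ≡⟨ cong ℕ→ℚ (ℕₚ.m+[n∸m]≡n m≤n) ⟩
  ℕ→ℚ n                    ∎
  where open ≤-Reasoning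

1/suc≤1 : ∀ n → + 1 / suc n ≤ 1ℚ
1/suc≤1 n = begin
  + 1 / suc n                    ≡⟨ *-identityˡ (+ 1 / suc n) ⟨
  1ℚ * (+ 1 / suc n)             ≤⟨ *-monoʳ-≤-≥0 (1/suc-nonNeg n) (ℕ→ℚ-mono-≤ {1} {suc n} (s≤s z≤n)) ⟩
  ℕ→ℚ (suc n) * (+ 1 / suc n)    ≡⟨ ℕ→ℚ-inverse n ⟩
  1ℚ                             ∎
  where open ≤-Reasoning

pow½-nonNeg : ∀ m → 0ℚ ≤ pow ½ m
pow½-nonNeg zero    = nonNegative⁻¹ 1ℚ
pow½-nonNeg (suc m) = *-≥0 (nonNegative⁻¹ ½) (pow½-nonNeg m)

ℕ→ℚ[2^m]*½^m≡1 : ∀ m → ℕ→ℚ (2 ℕ.^ m) * pow ½ m ≡ 1ℚ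
ℕ→ℚ[2^m]*½^m≡1 zero    = refl
ℕ→ℚ[2^m]*½^m≡1 (suc m) = begin
  ℕ→ℚ (2 ℕ.* 2 ℕ.^ m) * (½ * pow ½ m)           ≡⟨ cong (_* (½ * pow ½ m)) (ℕ→ℚ-* 2 (2 ℕ.^ m)) ⟩
  (ℕ→ℚ 2 * ℕ→ℚ (2 ℕ.^ m)) * (½ * pow ½ m)       ≡⟨ solve 2 (λ x y → (con (ℕ→ℚ 2) :* x) :* (con ½ :* y) := x :* y)
                                                           refl (ℕ→ℚ (2 ℕ.^ m)) (pow ½ m) ⟩
  ℕ→ℚ (2 ℕ.^ m) * pow ½ m                       ≡⟨ ℕ→ℚ[2^m]*½^m≡1 m ⟩
  1ℚ                                            ∎
  where open ≡-Reasoning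

totalSize-++ : ∀ xs ys → totalSize (xs ++ ys) ≡ totalSize xs + totalSize ys
totalSize-++ []       ys = sym (+-identityˡ (totalSize ys))
totalSize-++ (x ∷ xs) ys = trans (cong (λ t → size x + t) (totalSize-++ xs ys)) (sym (+-assoc (size x) _ _))

totalProfit-++ : ∀ xs ys → totalProfit (xs ++ ys) ≡ totalProfit xs + totalProfit ys
totalProfit-++ []       ys = sym (+-identityˡ (totalProfit ys))
totalProfit-++ (x ∷ xs) ys = trans (cong (λ t → profit x + t) (totalProfit-++ xs ys)) (sym (+-assoc (profit x) _ _))

totalSize-nonNeg : ∀ {xs} → All (λ a → 0ℚ ≤ size a) xs → 0ℚ ≤ totalSize xs
totalSize-nonNeg []         = ≤-refl
totalSize-nonNeg (px ∷ pxs) = +-mono-≤ px (totalSize-nonNeg pxs)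

totalProfit-nonNeg : ∀ {xs} → All (λ a → 0ℚ ≤ profit a) xs → 0ℚ ≤ totalProfit xs
totalProfit-nonNeg []         = ≤-refl
totalProfit-nonNeg (px ∷ pxs) = +-mono-≤ px (totalProfit-nonNeg pxs)

module _ {lo hi : ℚ} where

  countBand-accept : ∀ {a} xs → InBand lo hi a → countBand lo hi (a ∷ xs) ≡ suc (countBand lo hi xs)
  countBand-accept xs a∈ = cong length (Listₚ.filter-accept (inBand? lo hi) a∈)

  countBand-reject : ∀ {a} xs → ¬ InBand lo hi a → countBand lo hi (a ∷ xs) ≡ countBand lo hi xs
  countBand-reject xs a∉ = cong length (Listₚ.filter-reject (inBand? lo hi) a∉)

  countBand-none : ∀ {xs} → All (λ a → ¬ InBand lo hi a) xs → countBand lo hi xs ≡ 0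
  countBand-none none = cong length (Listₚ.filter-none (inBand? lo hi) none)

  countBand-++ : ∀ xs ys → countBand lo hi (xs ++ ys) ≡ countBand lo hi xs ℕ.+ countBand lo hi ys
  countBand-++ xs ys = trans (cong length (Listₚ.filter-++ (inBand? lo hi) xs ys))
                             (Listₚ.length-++ (filter (inBand? lo hi) xs))

interval-search : (g : ℕ → ℚ) (n : ℕ) {p : ℚ} → g 0 ≤ p → p < g n →
                  ∃[ i ] (i ℕ.< n × g i ≤ p × p < g (suc i))
interval-search g zero    g0≤p p<g0 = ⊥-elim (<⇒≱ p<g0 g0≤p)
interval-search g (suc n) {p} g0≤p p<g[n+1] with p <? g n
... | yes p<gn = let i , i<n , found = interval-search g n g0≤p p<gn in i , ℕₚ.m≤n⇒m≤1+n i<n , found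
... | no  p≮gn = n , ℕₚ.n<1+n n , ≮⇒≥ p≮gn , p<g[n+1]

[1-d]*p≤q : ∀ {d l p q} → 0ℚ ≤ d → l ≤ p → p < q + d * l → (1ℚ - d) * p ≤ q
[1-d]*p≤q {d} {l} {p} {q} 0≤d l≤p p<q+dl = +-cancelʳ-≤ (d * l) (<⇒≤ (begin-strict
  (1ℚ - d) * p + d * l    ≤⟨ +-monoʳ-≤ ((1ℚ - d) * p) (*-monoˡ-≤-≥0 0≤d l≤p) ⟩
  (1ℚ - d) * p + d * p    ≡⟨ solve 2 (λ d p → (con 1ℚ :- d) :* p :+ d :* p := p) refl d p ⟩
  p                       <⟨ p<q+dl ⟩
  q + d * l               ∎))
  where open ≤-Reasoning

module Accounting (f : ℚ) where

  -- ℓ is the copy of W left unpaired by a pass; it is settled without loss, so the profit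
  -- bound only needs to count it at f times its profit.
  record Accounted (W W' : List Item) (ℓ : Maybe Item) : Set where
    constructor accounted
    field
      size-bound   : totalSize W' + totalSize (fromMaybe ℓ) ≤ totalSize W
      profit-bound : f * totalProfit W ≤ totalProfit W' + f * totalProfit (fromMaybe ℓ)

  accounted-[] : Accounted [] [] nothing
  accounted-[] = accounted ≤-refl (≤-reflexive (solve 1 (λ f → f :* con 0ℚ := con 0ℚ :+ f :* con 0ℚ) refl f))

  accounted-∷ : ∀ {a c W W' ℓ} → size c ≤ size a → f * profit a ≤ profit c →
                Accounted W W' ℓ → Accounted (a ∷ W) (c ∷ W') ℓ
  accounted-∷ {a} {c} {W} {W'} {ℓ} c≤a fa≤c (accounted fits retains) = accounted
    (subst (_≤ size a + totalSize W) (sym (+-assoc (size c) _ _)) (+-mono-≤ c≤a fits))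
    (subst₂ _≤_ (sym (*-distribˡ-+ f (profit a) _)) (sym (+-assoc (profit c) _ _)) (+-mono-≤ fa≤c retains))

  accounted-park : ∀ {a W W'} → Accounted W W' nothing → Accounted (a ∷ W) W' (just a)
  accounted-park {a} {W} {W'} (accounted fits retains) = accounted
    (subst (_≤ size a + totalSize W)
          (solve 2 (λ s w → s :+ (w :+ con 0ℚ) := w :+ (s :+ con 0ℚ)) refl (size a) (totalSize W'))
          (+-monoʳ-≤ (size a) fits))
    (subst₂ _≤_ (sym (*-distribˡ-+ f (profit a) (totalProfit W)))
          (solve 3 (λ f p w → f :* p :+ (w :+ f :* con 0ℚ) := w :+ f :* (p :+ con 0ℚ)) refl f (profit a) (totalProfit W'))
          (+-monoʳ-≤ (f * profit a) retains))

  accounted-glue : ∀ {a b c W W'} → size c ≤ size (a ⊕ b) → f * profit (a ⊕ b) ≤ profit c →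
                   Accounted W W' (just b) → Accounted (a ∷ W) (c ∷ W') nothing
  accounted-glue {a} {b} {c} {W} {W'} c≤ab fab≤c (accounted fits retains) = accounted fits′ retains′
    where
    open ≤-Reasoning
    fits′ : size c + totalSize W' + 0ℚ ≤ size a + totalSize W
    fits′ = begin
      size c + totalSize W' + 0ℚ                  ≤⟨ +-monoˡ-≤ 0ℚ (+-monoˡ-≤ (totalSize W') c≤ab) ⟩
      size a + size b + totalSize W' + 0ℚ         ≡⟨ solve 3 (λ x y w → x :+ y :+ w :+ con 0ℚ := x :+ (w :+ (y :+ con 0ℚ)))
                                                       refl (size a) (size b) (totalSize W') ⟩
      size a + (totalSize W' + (size b + 0ℚ))     ≤⟨ +-monoʳ-≤ (size a) fits ⟩
      size a + totalSize W                        ∎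
    retains′ : f * (profit a + totalProfit W) ≤ profit c + totalProfit W' + f * 0ℚ
    retains′ = begin
      f * (profit a + totalProfit W)                       ≡⟨ *-distribˡ-+ f (profit a) (totalProfit W) ⟩
      f * profit a + f * totalProfit W                     ≤⟨ +-monoʳ-≤ (f * profit a) retains ⟩
      f * profit a + (totalProfit W' + f * (profit b + 0ℚ)) ≡⟨ solve 4 (λ f x y w → f :* x :+ (w :+ f :* (y :+ con 0ℚ))
                                                                       := f :* (x :+ y) :+ w :+ f :* con 0ℚ)
                                                                 refl f (profit a) (profit b) (totalProfit W') ⟩
      f * (profit a + profit b) + totalProfit W' + f * 0ℚ  ≤⟨ +-monoˡ-≤ (f * 0ℚ) (+-monoˡ-≤ (totalProfit W') fab≤c) ⟩
      profit c + totalProfit W' + f * 0ℚ                   ∎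

  leftover-size≤ : ∀ {b W W'} → 0ℚ ≤ totalSize W' → Accounted W W' (just b) → size b ≤ totalSize W
  leftover-size≤ {b} {W} {W'} 0≤W' (accounted fits _) = begin
    size b                          ≡⟨ +-identityʳ (size b) ⟨
    size b + 0ℚ                     ≤⟨ p≤q+p 0≤W' ⟩
    totalSize W' + (size b + 0ℚ)    ≤⟨ fits ⟩
    totalSize W                     ∎
    where open ≤-Reasoning

-- factor κ is 1ℚ - δ κ by definition; the subintervals L_{k,γ} have width δ κ * Llo κ P₀ k.
δ : ℕ → ℚ
δ κ = (eps κ * (½ * ½)) * (+ 1 / suc κ)

δ-nonNeg : ∀ κ → 0ℚ ≤ δ κ
δ-nonNeg κ = *-≥0 (*-≥0 (pow½-nonNeg (κ ℕ.∸ 1)) (nonNegative⁻¹ (½ * ½))) (1/suc-nonNeg κ)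

δ≤1 : ∀ κ → eps κ ≤ ½ * ½ → δ κ ≤ 1ℚ
δ≤1 κ ε≤¼ = begin
  (eps κ * (½ * ½)) * (+ 1 / suc κ)   ≤⟨ *-monoʳ-≤-≥0 (1/suc-nonNeg κ) (*-monoʳ-≤-≥0 (nonNegative⁻¹ (½ * ½)) ε≤¼) ⟩
  ((½ * ½) * (½ * ½)) * (+ 1 / suc κ) ≤⟨ q*p≤p (1/suc-nonNeg κ) (toWitness {a? = (½ * ½) * (½ * ½) ≤? 1ℚ} tt) ⟩
  + 1 / suc κ                         ≤⟨ 1/suc≤1 κ ⟩
  1ℚ                                  ∎
  where open ≤-Reasoning

Lhi≡Llo+Llo : ∀ κ P₀ k → Lhi κ P₀ k ≡ Llo κ P₀ k + Llo κ P₀ k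
Lhi≡Llo+Llo κ P₀ k = begin
  ℕ→ℚ (2 ℕ.^ k ℕ.+ (2 ℕ.^ k ℕ.+ 0)) * T    ≡⟨ cong (λ n → ℕ→ℚ (2 ℕ.^ k ℕ.+ n) * T) (ℕₚ.+-identityʳ (2 ℕ.^ k)) ⟩
  ℕ→ℚ (2 ℕ.^ k ℕ.+ 2 ℕ.^ k) * T            ≡⟨ cong (_* T) (ℕ→ℚ-+ (2 ℕ.^ k) (2 ℕ.^ k)) ⟩
  (ℕ→ℚ (2 ℕ.^ k) + ℕ→ℚ (2 ℕ.^ k)) * T      ≡⟨ *-distribʳ-+ T (ℕ→ℚ (2 ℕ.^ k)) (ℕ→ℚ (2 ℕ.^ k)) ⟩
  Llo κ P₀ k + Llo κ P₀ k                   ∎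
  where
  open ≡-Reasoning
  T : ℚ
  T = thrT κ P₀

Lglo-zero : ∀ κ P₀ k → Lglo κ P₀ k 0 ≡ Llo κ P₀ k
Lglo-zero κ P₀ k = solve 3 (λ N T K → N :* T :+ con 0ℚ :* N :* K := N :* T) refl
                     (ℕ→ℚ (2 ℕ.^ k)) (thrT κ P₀) (thrK κ P₀)

Lghi≡Lglo+δLlo : ∀ κ P₀ k γ → Lghi κ P₀ k γ ≡ Lglo κ P₀ k γ + δ κ * Llo κ P₀ k
Lghi≡Lglo+δLlo κ P₀ k γ = begin
  N * T + ℕ→ℚ (suc γ) * N * K       ≡⟨ cong (λ x → N * T + x * N * K) (ℕ→ℚ-+ 1 γ) ⟩
  N * T + (1ℚ + ℕ→ℚ γ) * N * K      ≡⟨ solve 5 (λ N T g r e →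
                                          N :* T :+ (con 1ℚ :+ g) :* N :* ((con ½ :* con ½) :* r :* e :* T)
                                          := N :* T :+ g :* N :* ((con ½ :* con ½) :* r :* e :* T)
                                             :+ (e :* (con ½ :* con ½)) :* r :* (N :* T))
                                        refl N T (ℕ→ℚ γ) (+ 1 / suc κ) (eps κ) ⟩
  Lglo κ P₀ k γ + δ κ * Llo κ P₀ k  ∎
  where
  open ≡-Reasoning
  N T K : ℚ
  N = ℕ→ℚ (2 ℕ.^ k)
  T = thrT κ P₀
  K = thrK κ P₀

Γ*K≡T : ∀ m P₀ → ℕ→ℚ (Γ (suc m)) * thrK (suc m) P₀ ≡ thrT (suc m) P₀
Γ*K≡T m P₀ = begin
  ℕ→ℚ (2 ℕ.* (2 ℕ.* 2 ℕ.^ m) ℕ.* suc (suc m)) * K    ≡⟨ cong (_* K) ℕ→ℚ-Γ ⟩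
  ℕ→ℚ 2 * (ℕ→ℚ 2 * N) * S * K                        ≡⟨ solve 5 (λ N S r e T →
                                                           con (ℕ→ℚ 2) :* (con (ℕ→ℚ 2) :* N) :* S :* ((con ½ :* con ½) :* r :* e :* T)
                                                           := (N :* e) :* (S :* r) :* T)
                                                         refl N S (+ 1 / suc (suc m)) (pow ½ m) T ⟩
  (N * pow ½ m) * (S * (+ 1 / suc (suc m))) * T      ≡⟨ cong₂ (λ x y → x * y * T) (ℕ→ℚ[2^m]*½^m≡1 m) (ℕ→ℚ-inverse (suc m)) ⟩
  1ℚ * 1ℚ * T                                        ≡⟨ *-identityˡ T ⟩
  T                                                  ∎
  where
  open ≡-Reasoning
  N S T K : ℚ
  N = ℕ→ℚ (2 ℕ.^ m)
  S = ℕ→ℚ (suc (suc m))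
  T = thrT (suc m) P₀
  K = thrK (suc m) P₀
  ℕ→ℚ-Γ : ℕ→ℚ (2 ℕ.* (2 ℕ.* 2 ℕ.^ m) ℕ.* suc (suc m)) ≡ ℕ→ℚ 2 * (ℕ→ℚ 2 * N) * S
  ℕ→ℚ-Γ = trans (ℕ→ℚ-* (2 ℕ.* (2 ℕ.* 2 ℕ.^ m)) (suc (suc m)))
                (cong (_* S) (trans (ℕ→ℚ-* 2 (2 ℕ.* 2 ℕ.^ m)) (cong (ℕ→ℚ 2 *_) (ℕ→ℚ-* 2 (2 ℕ.^ m)))))

Lglo-Γ≡Lhi : ∀ m P₀ k → Lglo (suc m) P₀ k (Γ (suc m)) ≡ Lhi (suc m) P₀ k
Lglo-Γ≡Lhi m P₀ k = begin
  N * T + ℕ→ℚ (Γ (suc m)) * N * K     ≡⟨ solve 4 (λ N T G K → N :* T :+ G :* N :* K := N :* T :+ N :* (G :* K))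
                                          refl N T (ℕ→ℚ (Γ (suc m))) K ⟩
  N * T + N * (ℕ→ℚ (Γ (suc m)) * K)   ≡⟨ cong (λ x → N * T + N * x) (Γ*K≡T m P₀) ⟩
  N * T + N * T                       ≡⟨ Lhi≡Llo+Llo (suc m) P₀ k ⟨
  Lhi (suc m) P₀ k                    ∎
  where
  open ≡-Reasoning
  N T K : ℚ
  N = ℕ→ℚ (2 ℕ.^ k)
  T = thrT (suc m) P₀
  K = thrK (suc m) P₀

validMin-just : ∀ {Cand lo hi m a} → m ≡ just a → ValidMin Cand lo hi m →
                Cand a × InBand lo hi a × (∀ b → Cand b → InBand lo hi b → size a ≤ size b)
validMin-just refl valid = valid

validMin-nothing : ∀ {Cand lo hi m} → m ≡ nothing → ValidMin Cand lo hi m → ∀ a → Cand a → ¬ InBand lo hi a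
validMin-nothing refl none = none

module Layers (m : ℕ) (P₀ : ℚ) (0≤T : 0ℚ ≤ thrT (suc m) P₀) (ε≤¼ : eps (suc m) ≤ ½ * ½) where

  κ : ℕ
  κ = suc m

  InL : ℕ → ℚ → Set
  InL k p = Llo κ P₀ k ≤ p × p < Lhi κ P₀ k

  InLsub : ℕ → ℕ → ℚ → Set
  InLsub k γ p = Lglo κ P₀ k γ ≤ p × p < Lghi κ P₀ k γ

  Llo-nonNeg : ∀ k → 0ℚ ≤ Llo κ P₀ k
  Llo-nonNeg k = *-≥0 (ℕ→ℚ-nonNeg (2 ℕ.^ k)) 0≤T

  Llo-mono : ∀ {j k} → j ℕ.≤ k → Llo κ P₀ j ≤ Llo κ P₀ k
  Llo-mono j≤k = *-monoʳ-≤-≥0 0≤T (ℕ→ℚ-mono-≤ (ℕₚ.^-monoʳ-≤ 2 j≤k))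

  Lhi≤Llo : ∀ {j k} → j ℕ.< k → Lhi κ P₀ j ≤ Llo κ P₀ k
  Lhi≤Llo = Llo-mono

  InL-unique : ∀ j k {p} → InL j p → InL k p → j ≡ k
  InL-unique j k (lo₁ , hi₁) (lo₂ , hi₂) = compare (ℕₚ.<-cmp j k)
    where
    compare : Tri (j ℕ.< k) (j ≡ k) (k ℕ.< j) → j ≡ k
    compare (tri< j<k _ _) = ⊥-elim (<⇒≱ hi₁ (≤-trans (Lhi≤Llo j<k) lo₂))
    compare (tri≈ _ j≡k _) = j≡k
    compare (tri> _ _ k<j) = ⊥-elim (<⇒≱ hi₂ (≤-trans (Lhi≤Llo k<j) lo₁))

  InL-+ : ∀ j {p q} → InL j p → InL j q → InL (suc j) (p + q)
  InL-+ j (lo₁ , hi₁) (lo₂ , hi₂) =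
    subst (_≤ _) (sym (Lhi≡Llo+Llo κ P₀ j)) (+-mono-≤ lo₁ lo₂) ,
    subst (_ <_) (sym (Lhi≡Llo+Llo κ P₀ (suc j))) (+-mono-< hi₁ hi₂)

  Lglo-mono : ∀ k {γ γ'} → γ ℕ.≤ γ' → Lglo κ P₀ k γ ≤ Lglo κ P₀ k γ'
  Lglo-mono k γ≤γ' = +-monoʳ-≤ (Llo κ P₀ k)
    (*-monoʳ-≤-≥0 0≤K (*-monoʳ-≤-≥0 (ℕ→ℚ-nonNeg (2 ℕ.^ k)) (ℕ→ℚ-mono-≤ γ≤γ')))
    where
    0≤K : 0ℚ ≤ thrK κ P₀
    0≤K = *-≥0 (*-≥0 (*-≥0 (nonNegative⁻¹ (½ * ½)) (1/suc-nonNeg κ)) (pow½-nonNeg m)) 0≤T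

  InLsub⇒InL : ∀ k {γ p} → γ ℕ.< Γ κ → InLsub k γ p → InL k p
  InLsub⇒InL k {γ} γ<Γ (lo , hi) =
    ≤-trans (≤-reflexive (sym (Lglo-zero κ P₀ k))) (≤-trans (Lglo-mono k {0} {γ} z≤n) lo) ,
    <-≤-trans hi (≤-trans (Lglo-mono k γ<Γ) (≤-reflexive (Lglo-Γ≡Lhi m P₀ k)))

  InL⇒InLsub : ∀ k {p} → InL k p → ∃[ γ ] (γ ℕ.< Γ κ × InLsub k γ p)
  InL⇒InLsub k {p} (lo , hi) =
    interval-search (Lglo κ P₀ k) (Γ κ) (subst (_≤ p) (sym (Lglo-zero κ P₀ k)) lo)
                                        (subst (p <_) (sym (Lglo-Γ≡Lhi m P₀ k)) hi)

  f : ℚ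
  f = factor κ

  f≤1 : f ≤ 1ℚ
  f≤1 = 1-p≤1 (δ-nonNeg κ)

  0≤f : 0ℚ ≤ f
  0≤f = 0≤1-p (δ≤1 κ ε≤¼)

  open Accounting f

  module _ (I : List Item) (sizes : ∀ a → a ∈ I → 0ℚ ≤ size a)
           (sel tsel : ℕ → ℕ → Maybe Item)
           (valid : ValidRed I κ P₀ sel) (tvalid : ValidTilde κ P₀ sel tsel) where

    Sound : ℕ → Item → Set
    Sound k a = InL k (profit a) × 0ℚ ≤ size a

    sel-sound : ∀ {k a} → k ℕ.≤ κ → InIk κ sel k a → Sound k a
    sel-sound {k} {a} k≤κ (γ , γ<Γ , eq) =
      let (a∈I , _) , a∈sub , _ = validMin-just eq (valid k γ k≤κ γ<Γ)
      in InLsub⇒InL k γ<Γ a∈sub , sizes a a∈I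

    tsel-sound : ∀ k {a} → k ℕ.≤ κ → InIk κ tsel k a → Sound k a
    tsel-sound zero    k≤κ (γ , γ<Γ , eq) = sel-sound k≤κ (γ , γ<Γ , trans (sym (proj₁ tvalid γ γ<Γ)) eq)
    tsel-sound (suc k) k<κ (γ , γ<Γ , eq) =
      let cand , a∈sub , _ = validMin-just eq (proj₂ tvalid k γ k<κ γ<Γ)
      in InLsub⇒InL (suc k) γ<Γ a∈sub , candidate-size cand
      where
      candidate-size : ∀ {x} → CandTilde κ sel tsel k x → 0ℚ ≤ size x
      candidate-size (inj₁ x∈Ik) = proj₂ (sel-sound k<κ x∈Ik)
      candidate-size (inj₂ (b , b' , b∈Ĩk , b'∈Ĩk , _ , refl)) =
        +-≥0 (proj₂ (tsel-sound k (ℕₚ.<⇒≤ k<κ) b∈Ĩk)) (proj₂ (tsel-sound k (ℕₚ.<⇒≤ k<κ) b'∈Ĩk))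

    tsel-zero : ∀ {a} → InIk κ sel 0 a → InIk κ tsel 0 a
    tsel-zero (γ , γ<Γ , eq) = γ , γ<Γ , trans (proj₁ tvalid γ γ<Γ) eq

    Replacement : ℕ → Item → Set
    Replacement j a = ∃[ c ] (InIk κ tsel (suc j) c × size c ≤ size a × f * profit a ≤ profit c)

    replace-in : ∀ {j a} γ → j ℕ.< κ → γ ℕ.< Γ κ → CandTilde κ sel tsel j a →
                 InLsub (suc j) γ (profit a) → Replacement j a
    replace-in {j} {a} γ j<κ γ<Γ cand a∈sub = choose (tsel (suc j) γ) refl
      where
      choose : (mc : Maybe Item) → tsel (suc j) γ ≡ mc → Replacement j a
      choose nothing  eq = ⊥-elim (validMin-nothing eq (proj₂ tvalid j γ j<κ γ<Γ) a cand a∈sub)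
      choose (just c) eq =
        let _ , (c-lo , _) , minimal = validMin-just eq (proj₂ tvalid j γ j<κ γ<Γ)
        in c , (γ , γ<Γ , eq) , minimal a cand a∈sub , keeps-profit c-lo
        where
        keeps-profit : Lglo κ P₀ (suc j) γ ≤ profit c → f * profit a ≤ profit c
        keeps-profit c-lo =
          [1-d]*p≤q {δ κ} {Llo κ P₀ (suc j)} {profit a} {profit c}
            (δ-nonNeg κ) (proj₁ (InLsub⇒InL (suc j) γ<Γ a∈sub)) (begin-strict
              profit a                                       <⟨ proj₂ a∈sub ⟩
              Lghi κ P₀ (suc j) γ                            ≡⟨ Lghi≡Lglo+δLlo κ P₀ (suc j) γ ⟩
              Lglo κ P₀ (suc j) γ + δ κ * Llo κ P₀ (suc j)   ≤⟨ +-monoˡ-≤ (δ κ * Llo κ P₀ (suc j)) c-lo ⟩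
              profit c + δ κ * Llo κ P₀ (suc j)              ∎)
          where open ≤-Reasoning

    replace : ∀ {j a} → j ℕ.< κ → CandTilde κ sel tsel j a → InL (suc j) (profit a) → Replacement j a
    replace {j} j<κ cand a∈L =
      let γ , γ<Γ , a∈sub = InL⇒InLsub (suc j) a∈L in replace-in γ j<κ γ<Γ cand a∈sub

    Settled Pending : ℕ → Item → Set
    Settled j a = ∃[ k ] (k ℕ.< j × InIk κ tsel k a)
    Pending j a = InIk κ tsel j a ⊎ ∃[ k ] (j ℕ.< k × k ℕ.≤ κ × InIk κ sel k a)

    settled-bounds : ∀ {j a} → j ℕ.≤ κ → Settled j a →
                     (0ℚ ≤ profit a × profit a < Llo κ P₀ j) × 0ℚ ≤ size a
    settled-bounds j≤κ (k , k<j , a∈Ĩk) =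
      let (lo , hi) , 0≤size = tsel-sound k (ℕₚ.≤-trans (ℕₚ.<⇒≤ k<j) j≤κ) a∈Ĩk
      in (≤-trans (Llo-nonNeg k) lo , <-≤-trans hi (Lhi≤Llo k<j)) , 0≤size

    pending-bounds : ∀ {j a} → j ℕ.≤ κ → Pending j a → Llo κ P₀ j ≤ profit a × 0ℚ ≤ size a
    pending-bounds {j} j≤κ (inj₁ a∈Ĩj) = let (lo , _) , 0≤size = tsel-sound j j≤κ a∈Ĩj in lo , 0≤size
    pending-bounds j≤κ (inj₂ (k , j<k , k≤κ , a∈Ik)) =
      let (lo , _) , 0≤size = sel-sound k≤κ a∈Ik in ≤-trans (Llo-mono (ℕₚ.<⇒≤ j<k)) lo , 0≤size

    PassResult : ℕ → List Item → Set
    PassResult j W = ∃[ W' ] ∃[ ℓ ]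
      (All (Pending (suc j)) W' × Maybe.All (InIk κ tsel j) ℓ × Accounted W W' ℓ)

    pass-sel : ∀ {j k a W} → j ℕ.< κ → k ℕ.≤ κ → InIk κ sel k a → suc j ℕ.< k ⊎ suc j ≡ k →
               PassResult j W → PassResult j (a ∷ W)
    pass-sel {k = k} {a} j<κ k≤κ a∈Ik (inj₁ j+1<k) (W' , ℓ , W'-pending , ℓ-ok , acc) =
      a ∷ W' , ℓ , inj₂ (k , j+1<k , k≤κ , a∈Ik) ∷ W'-pending , ℓ-ok ,
      accounted-∷ ≤-refl (q*p≤p 0≤profit f≤1) acc
      where
      0≤profit : 0ℚ ≤ profit a
      0≤profit = ≤-trans (Llo-nonNeg k) (proj₁ (proj₁ (sel-sound k≤κ a∈Ik)))
    pass-sel j<κ k≤κ a∈Ik (inj₂ refl) (W' , ℓ , W'-pending , ℓ-ok , acc) =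
      let c , c∈Ĩ , c≤a , fa≤c = replace j<κ (inj₁ a∈Ik) (proj₁ (sel-sound k≤κ a∈Ik))
      in c ∷ W' , ℓ , inj₁ c∈Ĩ ∷ W'-pending , ℓ-ok , accounted-∷ c≤a fa≤c acc

    pass-∷ : ∀ {j a W} → j ℕ.< κ → Pending j a → size a + totalSize W ≤ 1ℚ →
             PassResult j W → PassResult j (a ∷ W)
    pass-∷ j<κ (inj₂ (k , j<k , k≤κ , a∈Ik)) _ result = pass-sel j<κ k≤κ a∈Ik (ℕₚ.m≤n⇒m<n∨m≡n j<k) result
    pass-∷ {a = a} j<κ (inj₁ a∈Ĩj) _ (W' , nothing , W'-pending , nothing , acc) =
      W' , just a , W'-pending , just a∈Ĩj , accounted-park acc
    pass-∷ {j} {a} j<κ (inj₁ a∈Ĩj) a+W≤1 (W' , just b , W'-pending , just b∈Ĩj , acc) =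
      let c , c∈Ĩ , c≤ab , fab≤c = replace j<κ (inj₂ (a , b , a∈Ĩj , b∈Ĩj , a+b≤1 , refl)) a⊕b∈L
      in c ∷ W' , nothing , inj₁ c∈Ĩ ∷ W'-pending , nothing , accounted-glue c≤ab fab≤c acc
      where
      0≤W' : 0ℚ ≤ totalSize W'
      0≤W' = totalSize-nonNeg (All.map (λ x-pending → proj₂ (pending-bounds j<κ x-pending)) W'-pending)
      a+b≤1 : size a + size b ≤ 1ℚ
      a+b≤1 = ≤-trans (+-monoʳ-≤ (size a) (leftover-size≤ 0≤W' acc)) a+W≤1
      a⊕b∈L : InL (suc j) (profit a + profit b)
      a⊕b∈L = InL-+ j (proj₁ (tsel-sound j (ℕₚ.<⇒≤ j<κ) a∈Ĩj)) (proj₁ (tsel-sound j (ℕₚ.<⇒≤ j<κ) b∈Ĩj))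

    pass : ∀ {j} → j ℕ.< κ → (W : List Item) → All (Pending j) W → totalSize W ≤ 1ℚ → PassResult j W
    pass j<κ []      []                     _     = [] , nothing , [] , nothing , accounted-[]
    pass j<κ (a ∷ W) (a-pending ∷ W-pending) a+W≤1 = pass-∷ j<κ a-pending a+W≤1 (pass j<κ W W-pending W≤1)
      where
      W≤1 : totalSize W ≤ 1ℚ
      W≤1 = ≤-trans (p≤q+p (proj₂ (pending-bounds (ℕₚ.<⇒≤ j<κ) a-pending))) a+W≤1

    settled-suc : ∀ {j a} → Settled j a → Settled (suc j) a
    settled-suc (k , k<j , a∈Ĩk) = k , ℕₚ.m≤n⇒m≤1+n k<j , a∈Ĩk

    leftover-settled : ∀ {j ℓ} → Maybe.All (InIk κ tsel j) ℓ → All (Settled (suc j)) (fromMaybe ℓ)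
    leftover-settled {j} (just b∈Ĩj) = (j , ℕₚ.n<1+n j , b∈Ĩj) ∷ []
    leftover-settled nothing          = []

    structured-push : ∀ {j ℓ S} → j ℕ.≤ κ → Maybe.All (InIk κ tsel j) ℓ → All (Settled j) S →
                      (∀ k → countBand (Llo κ P₀ k) (Lhi κ P₀ k) S ℕ.≤ 1) →
                      ∀ k → countBand (Llo κ P₀ k) (Lhi κ P₀ k) (fromMaybe ℓ ++ S) ℕ.≤ 1
    structured-push _ nothing _ S-structured k = S-structured k
    structured-push {j} {just b} {S} j≤κ (just b∈Ĩj) S-settled S-structured k =
      by-cases (inBand? (Llo κ P₀ k) (Lhi κ P₀ k) b)
      where
      by-cases : Dec (InL k (profit b)) → countBand (Llo κ P₀ k) (Lhi κ P₀ k) (b ∷ S) ℕ.≤ 1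
      by-cases (no b∉Lk)  = subst (ℕ._≤ 1) (sym (countBand-reject S b∉Lk)) (S-structured k)
      by-cases (yes b∈Lk) = ℕₚ.≤-reflexive (trans (countBand-accept S b∈Lk) (cong suc (countBand-none S∉Lk)))
        where
        k≡j : k ≡ j
        k≡j = InL-unique k j b∈Lk (proj₁ (tsel-sound j j≤κ b∈Ĩj))
        S∉Lk : All (λ x → ¬ InL k (profit x)) S
        S∉Lk = All.map (λ x-settled x∈Lk → <⇒≱ (proj₂ (proj₁ (settled-bounds j≤κ x-settled)))
                                              (subst (λ i → Llo κ P₀ i ≤ _) k≡j (proj₁ x∈Lk)))
                       S-settled

    module _ (v : ℚ) (v≤1 : v ≤ 1ℚ) (xs : List Item) (xs-red : All (InRed κ sel) xs)
             (xs-fits : totalSize xs ≤ v) where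

      record Round (j : ℕ) : Set where
        field
          settled pending    : List Item
          settled-ok         : All (Settled j) settled
          pending-ok         : All (Pending j) pending
          settled-structured : ∀ k → countBand (Llo κ P₀ k) (Lhi κ P₀ k) settled ℕ.≤ 1
          fits               : totalSize settled + totalSize pending ≤ v
          retains            : pow f j * totalProfit xs ≤ totalProfit settled + totalProfit pending

      red⇒pending : ∀ {a} → InRed κ sel a → Pending 0 a
      red⇒pending (zero  , _   , a∈I₀) = inj₁ (tsel-zero a∈I₀)
      red⇒pending (suc k , k≤κ , a∈Ik) = inj₂ (suc k , s≤s z≤n , k≤κ , a∈Ik)

      round-zero : Round 0
      round-zero = record
        { settled            = []
        ; pending            = xs
        ; settled-ok         = []
        ; pending-ok         = All.map red⇒pending xs-red
        ; settled-structured = λ _ → z≤n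
        ; fits               = subst (_≤ v) (sym (+-identityˡ (totalSize xs))) xs-fits
        ; retains            = ≤-reflexive (trans (*-identityˡ (totalProfit xs)) (sym (+-identityˡ (totalProfit xs))))
        }

      round-suc : ∀ {j} → j ℕ.< κ → Round j → Round (suc j)
      round-suc {j} j<κ r = advance (pass j<κ pending pending-ok pending≤1)
        where
        open Round r
        j≤κ : j ℕ.≤ κ
        j≤κ = ℕₚ.<⇒≤ j<κ
        pending≤1 : totalSize pending ≤ 1ℚ
        pending≤1 = ≤-trans (≤-trans (p≤q+p 0≤settled) fits) v≤1
          where
          0≤settled : 0ℚ ≤ totalSize settled
          0≤settled = totalSize-nonNeg (All.map (λ s → proj₂ (settled-bounds j≤κ s)) settled-ok)
        advance : PassResult j pending → Round (suc j)
        advance (W' , ℓ , W'-pending , ℓ-ok , accounted W'-fits W'-retains) = record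
          { settled            = fromMaybe ℓ ++ settled
          ; pending            = W'
          ; settled-ok         = ++⁺ (leftover-settled ℓ-ok) (All.map settled-suc settled-ok)
          ; pending-ok         = W'-pending
          ; settled-structured = structured-push j≤κ ℓ-ok settled-ok settled-structured
          ; fits               = fits′
          ; retains            = retains′
          }
          where
          open ≤-Reasoning
          S L : ℚ
          S = totalProfit settled
          L = totalProfit (fromMaybe ℓ)
          0≤S : 0ℚ ≤ S
          0≤S = totalProfit-nonNeg (All.map (λ s → proj₁ (proj₁ (settled-bounds j≤κ s))) settled-ok)
          0≤L : 0ℚ ≤ L
          0≤L = totalProfit-nonNeg (All.map (λ s → proj₁ (proj₁ (settled-bounds j<κ s))) (leftover-settled ℓ-ok))
          fits′ : totalSize (fromMaybe ℓ ++ settled) + totalSize W' ≤ v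
          fits′ = begin
            totalSize (fromMaybe ℓ ++ settled) + totalSize W'
              ≡⟨ cong (_+ totalSize W') (totalSize-++ (fromMaybe ℓ) settled) ⟩
            totalSize (fromMaybe ℓ) + totalSize settled + totalSize W'
              ≡⟨ solve 3 (λ l s w → l :+ s :+ w := s :+ (w :+ l)) refl _ (totalSize settled) (totalSize W') ⟩
            totalSize settled + (totalSize W' + totalSize (fromMaybe ℓ))
              ≤⟨ +-monoʳ-≤ (totalSize settled) W'-fits ⟩
            totalSize settled + totalSize pending
              ≤⟨ fits ⟩
            v ∎
          retains′ : pow f (suc j) * totalProfit xs ≤ totalProfit (fromMaybe ℓ ++ settled) + totalProfit W'
          retains′ = begin
            f * pow f j * totalProfit xs          ≡⟨ *-assoc f (pow f j) (totalProfit xs) ⟩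
            f * (pow f j * totalProfit xs)        ≤⟨ *-monoˡ-≤-≥0 0≤f retains ⟩
            f * (S + totalProfit pending)         ≡⟨ *-distribˡ-+ f S (totalProfit pending) ⟩
            f * S + f * totalProfit pending       ≤⟨ +-mono-≤ (q*p≤p 0≤S f≤1) W'-retains ⟩
            S + (totalProfit W' + f * L)          ≤⟨ +-monoʳ-≤ S (+-monoʳ-≤ (totalProfit W') (q*p≤p 0≤L f≤1)) ⟩
            S + (totalProfit W' + L)              ≡⟨ solve 3 (λ s w l → s :+ (w :+ l) := l :+ s :+ w) refl S (totalProfit W') L ⟩
            L + S + totalProfit W'                ≡⟨ cong (_+ totalProfit W') (totalProfit-++ (fromMaybe ℓ) settled) ⟨
            totalProfit (fromMaybe ℓ ++ settled) + totalProfit W' ∎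

      rounds : ∀ j → j ℕ.≤ κ → Round j
      rounds zero    _   = round-zero
      rounds (suc j) j<κ = round-suc j<κ (rounds j (ℕₚ.<⇒≤ j<κ))

      settled⇒mixed : ∀ {k₀ a} → Settled (suc k₀) a → InMixed κ sel tsel k₀ a
      settled⇒mixed (k , k<k₀+1 , a∈Ĩk) = inj₁ (k , ℕₚ.<⇒≤ k<k₀+1 , a∈Ĩk)

      pending⇒mixed : ∀ {k₀ a} → Pending (suc k₀) a → InMixed κ sel tsel k₀ a
      pending⇒mixed {k₀} (inj₁ a∈Ĩ) = inj₁ (suc k₀ , ℕₚ.≤-refl , a∈Ĩ)
      pending⇒mixed (inj₂ later)     = inj₂ later

      solution : ∀ k₀ → k₀ ℕ.< κ →
        ∃[ ys ] (All (InMixed κ sel tsel k₀) ys × totalSize ys ≤ v × Structured κ P₀ k₀ ys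
                 × pow f (suc k₀) * totalProfit xs ≤ totalProfit ys)
      solution k₀ k₀<κ =
        settled ++ pending ,
        ++⁺ (All.map settled⇒mixed settled-ok) (All.map pending⇒mixed pending-ok) ,
        subst (_≤ v) (sym (totalSize-++ settled pending)) fits ,
        structured ,
        subst (pow f (suc k₀) * totalProfit xs ≤_) (sym (totalProfit-++ settled pending)) retains
        where
        open Round (rounds (suc k₀) k₀<κ)
        structured : Structured κ P₀ k₀ (settled ++ pending)
        structured k k≤k₀ = subst (ℕ._≤ 1) (sym count≡) (settled-structured k)
          where
          pending∉Lk : All (λ x → ¬ InL k (profit x)) pending
          pending∉Lk = All.map (λ x-pending x∈Lk → <⇒≱ (proj₂ x∈Lk)
                                 (≤-trans (Lhi≤Llo (s≤s k≤k₀)) (proj₁ (pending-bounds k₀<κ x-pending))))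
                               pending-ok
          count≡ : countBand (Llo κ P₀ k) (Lhi κ P₀ k) (settled ++ pending)
                   ≡ countBand (Llo κ P₀ k) (Lhi κ P₀ k) settled
          count≡ = trans (countBand-++ settled pending)
                         (trans (cong (countBand (Llo κ P₀ k) (Lhi κ P₀ k) settled ℕ.+_) (countBand-none pending∉Lk))
                                (ℕₚ.+-identityʳ _))

theorem5 : (I : List Item) →
    (∀ a → a ∈ I → (0ℚ < profit a × profit a ≤ 1ℚ) × (0ℚ < size a × size a ≤ 1ℚ)) →
    (κ : ℕ) → eps κ ≤ ½ * ½ →
    (ame : Item) → ame ∈ I →
    (∀ a → a ∈ I → profit a * size ame ≤ profit ame * size a) →
    (n : ℕ) → ℕ→ℚ n * size ame ≤ 1ℚ → 1ℚ < ℕ→ℚ (suc n) * size ame →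
    (P₀ : ℚ) → P₀ ≡ profit ame * ℕ→ℚ n →
    (∀ a → a ∈ I → ¬ (profit a ≡ ℕ→ℚ 2 * P₀)) →
    (sel tsel : ℕ → ℕ → Maybe Item) →
    ValidRed I κ P₀ sel → ValidTilde κ P₀ sel tsel →
    (v : ℚ) → 0ℚ ≤ v → v ≤ 1ℚ →
    (k₀ : ℕ) → k₀ ℕ.< κ →
    (xs : List Item) → All (InRed κ sel) xs → totalSize xs ≤ v →
    ∃[ ys ] (All (InMixed κ sel tsel k₀) ys × totalSize ys ≤ v × Structured κ P₀ k₀ ys
             × pow (factor κ) (suc k₀) * totalProfit xs ≤ totalProfit ys)
theorem5 _ _ zero _ _ _ _ _ _ _ _ _ _ _ _ _ _ _ _ _ _ () _ _ _
theorem5 I bounds (suc m) ε≤¼ ame ame∈I _ n _ _ _ refl _ sel tsel valid tvalid v _ v≤1 k₀ k₀<κ xs xs-red xs-fits =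
  Layers.solution m (profit ame * ℕ→ℚ n) 0≤T ε≤¼ I sizes sel tsel valid tvalid v v≤1 xs xs-red xs-fits k₀ k₀<κ
  where
  sizes : ∀ a → a ∈ I → 0ℚ ≤ size a
  sizes a a∈I = <⇒≤ (proj₁ (proj₂ (bounds a a∈I)))
  0≤T : 0ℚ ≤ thrT (suc m) (profit ame * ℕ→ℚ n)
  0≤T = *-≥0 (*-≥0 (nonNegative⁻¹ ½) (pow½-nonNeg m))
              (*-≥0 (<⇒≤ (proj₁ (proj₁ (bounds ame ame∈I)))) (ℕ→ℚ-nonNeg n))
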